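{- Let $S$ be a finite set of PLTL-clauses. During the construction of the reduced behaviour graph of $S$ (by repeated application of the two deletion rules), any node that is reachable from a deleted node (in the graph at the time of that deletion) is also deleted.
   Context: A literal is a proposition symbol or its negation. A PLTL-clause has one of the forms $\mathbf{start}\Rightarrow\bigvee_c l_c$ (initial clause), $\bigwedge_a k_a\Rightarrow\bigcirc\bigvee_d l_d$ (step clause), $\bigwedge_b k_b\Rightarrow\Diamond l$ (sometime clause), all $k,l$ literals ($\bigcirc$ = next, $\Diamond$ = sometime, $\mathbf{start}$ true only at the first moment). The literals $l$ on the right of sometime clauses are the eventuality literals. Behaviour graph of $S$: consider the directed graph whose nodes are all pairs $(V,E)$ with $V$ a valuation of the proposition symbols occurring in $S$ and $E$ a subset of the eventuality literals of $S$. For a node $(V,E)$, let $L$ be the set of right-hand sides (with $\bigcirc$ removed) of step clauses of $S$ whose left-hand sides are satisfied by $V$, and $E'$ the elements of $E$ not satisfied by $V$; for each valuation $V'$ satisfying all of $L$, with $E''$ the set of eventuality literals $l$ of sometime clauses $C\Rightarrow\Diamond l$ in $S$ whose $C$ is satisfied by $V'$, there is an edge $(V,E)\to(V',E'\cup E'')$, and no others leave $(V,E)$. A node $(V,E')$ is initial if $V$ satisfies the right-hand sides of all initial clauses of $S$ and $E'$ is the set of eventuality literals of sometime clauses whose left-hand sides $V$ satisfies. The behaviour graph is the subgraph induced by nodes reachable from initial nodes, with its initial nodes designated. Reduced behaviour graph: starting from the behaviour graph, apply the following deletions repeatedly until none is possible: (i) delete any node with no successors (and all edges into it); (ii) delete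 any node $n=(V,E)$ such that some $l\in E$ is not satisfied by $V$ and there is no path from $n$ to a node whose valuation satisfies $l$. -}

module Defs where

open import Data.Nat using (ℕ; suc; _≤_; _<_)
open import Data.Fin using (Fin)
open import Data.Fin.Subset using (Subset; _∈_)
open import Data.Bool using (Bool; true; false)
open import Data.Vec using (Vec; lookup)
open import Data.List using (List; _∷_; [])
open import Data.List.Membership.Propositional renaming (_∈_ to _∈ˡ_)
open import Data.List.Relation.Unary.All using (All)
open import Data.List.Relation.Unary.Any using (Any)
open import Data.Product using (Σ; ∃; _×_; _,_; proj₁; proj₂)
open import Data.Sum using (_⊎_)
open import Relation.Nullary using (¬_)
open import Relation.Binary.PropositionalEquality using (_≡_; _≢_)
open import Relation.Binary.Construct.Closure.ReflexiveTransitive using (Star)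
open import Function.Bundles using (_⇔_)

data Literal (n : ℕ) : Set where
  pos : Fin n → Literal n
  neg : Fin n → Literal n

symbolOf : ∀ {n} → Literal n → Fin n
symbolOf (pos p) = p
symbolOf (neg p) = p

data Clause (n : ℕ) : Set where
  -- start ⇒ ⋁ rhs
  initial  : (rhs : List (Literal n)) → Clause n
  -- ⋀ lhs ⇒ ○ ⋁ rhs
  step     : (lhs : List (Literal n)) → (rhs : List (Literal n)) → Clause n
  -- ⋀ lhs ⇒ ◇ l
  sometime : (lhs : List (Literal n)) → (l : Literal n) → Clause n

literalsOf : ∀ {n} → Clause n → List (Literal n)
literalsOf (initial rhs) = rhs
literalsOf (step lhs rhs) = Data.List._++_ lhs rhs
literalsOf (sometime lhs l) = l ∷ lhs

ClauseSet : ℕ → Set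
ClauseSet n = List (Clause n)

OccursIn : ∀ {n} → Fin n → ClauseSet n → Set
OccursIn p S = Any (λ c → Any (λ l → symbolOf l ≡ p) (literalsOf c)) S

Valuation : ℕ → Set
Valuation n = Vec Bool n

_⊨ₗ_ : ∀ {n} → Valuation n → Literal n → Set
V ⊨ₗ pos p = lookup V p ≡ true
V ⊨ₗ neg p = lookup V p ≡ false

_⊨∧_ : ∀ {n} → Valuation n → List (Literal n) → Set
V ⊨∧ ls = All (V ⊨ₗ_) ls

_⊨∨_ : ∀ {n} → Valuation n → List (Literal n) → Set
V ⊨∨ ls = Any (V ⊨ₗ_) ls

-- Sets of (eventuality) literals: a pair (positive part, negative part)

LitSet : ℕ → Set
LitSet n = Subset n × Subset n

_∈ₑ_ : ∀ {n} → Literal n → LitSet n → Set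
pos p ∈ₑ E = p ∈ proj₁ E
neg p ∈ₑ E = p ∈ proj₂ E

Node : ℕ → Set
Node n = Valuation n × LitSet n

val : ∀ {n} → Node n → Valuation n
val = proj₁

evs : ∀ {n} → Node n → LitSet n
evs = proj₂

-- l is the eventuality literal of some sometime clause C ⇒ ◇ l of S
-- whose left-hand side C is satisfied by V   (the set E'' / initial E)
TriggeredEv : ∀ {n} → ClauseSet n → Valuation n → Literal n → Set
TriggeredEv S V l = ∃ λ C → (sometime C l ∈ˡ S) × (V ⊨∧ C)

Initial : ∀ {n} → ClauseSet n → Node n → Set
Initial S (V , E) =
  (∀ rhs → initial rhs ∈ˡ S → V ⊨∨ rhs) ×
  (∀ l → (l ∈ₑ E) ⇔ TriggeredEv S V l)

-- edges (V , E) → (V' , E' ∪ E'')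
Edge : ∀ {n} → ClauseSet n → Node n → Node n → Set
Edge S (V , E) (V' , E₁) =
  (∀ lhs rhs → step lhs rhs ∈ˡ S → V ⊨∧ lhs → V' ⊨∨ rhs) ×
  (∀ l → (l ∈ₑ E₁) ⇔ (((l ∈ₑ E) × ¬ (V ⊨ₗ l)) ⊎ TriggeredEv S V' l))

InBehaviourGraph : ∀ {n} → ClauseSet n → Node n → Set
InBehaviourGraph S m = ∃ λ i → Initial S i × Star (Edge S) i m

-- Graphs during the reduction: a set of nodes (with the induced edges)

NodeSet : ℕ → Set₁
NodeSet n = Node n → Set

EdgeIn : ∀ {n} → ClauseSet n → NodeSet n → Node n → Node n → Set
EdgeIn S G x y = G x × G y × Edge S x y

PathIn : ∀ {n} → ClauseSet n → NodeSet n → Node n → Node n → Set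
PathIn S G = Star (EdgeIn S G)

-- deletion rule (i): m has no successors in G
NoSuccessors : ∀ {n} → ClauseSet n → NodeSet n → Node n → Set
NoSuccessors S G m = ∀ y → ¬ EdgeIn S G m y

-- deletion rule (ii): some l ∈ E not satisfied by V with no path in G
-- from m to a node whose valuation satisfies l
UnfulfillableEv : ∀ {n} → ClauseSet n → NodeSet n → Node n → Set
UnfulfillableEv S G m =
  ∃ λ l → (l ∈ₑ evs m) × ¬ (val m ⊨ₗ l) ×
          ¬ (∃ λ y → PathIn S G m y × (val y ⊨ₗ l))

Deletable : ∀ {n} → ClauseSet n → NodeSet n → Node n → Set
Deletable S G m = G m × (NoSuccessors S G m ⊎ UnfulfillableEv S G m)

DeletionStep : ∀ {n} → ClauseSet n → NodeSet n → Node n → NodeSet n → Set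
DeletionStep S G m G' =
  Deletable S G m × (∀ x → G' x ⇔ (G x × x ≢ m))

Reduced : ∀ {n} → ClauseSet n → NodeSet n → Set
Reduced S G = ∀ m → ¬ Deletable S G m

record Construction {n : ℕ} (S : ClauseSet n) : Set₁ where
  field
    k       : ℕ
    G       : ℕ → NodeSet n
    d       : ℕ → Node n
    start   : ∀ x → G 0 x ⇔ InBehaviourGraph S x
    steps   : ∀ i → i < k → DeletionStep S (G i) (d i) (G (suc i))
    final   : Reduced S (G k)

-- A node deleted by rule (i) has no successors, so a node reachable from a
-- deleted node d along a nonempty path arises only under rule (ii).  The
-- unfulfilled eventuality l of d is carried along every path (it is not
-- satisfied, so it stays in E), and every node on the path still cannot
-- reach l, in the current graph and a fortiori in every later, smaller one.
-- So such a node cannot survive into the reduced graph; being present when d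
-- is deleted, it is deleted at some later step.
{-# OPTIONS --safe #-}
module Submission where

open import Defs
open import Data.Nat using (ℕ; suc; _≤_; _<_; _≤′_; ≤′-refl; ≤′-step)
open import Data.Nat.Properties using (≤-refl; <⇒≤; m<n⇒m<1+n; n<1+n; ≤⇒≤′; ≤′⇒≤)
open import Data.Fin using (Fin)
open import Data.Product using (∃; _×_; _,_; proj₁; proj₂)
open import Data.Sum using (inj₁; inj₂)
open import Data.Empty using (⊥-elim)
open import Function using (id; _∘_)
open import Function.Bundles using (_⇔_; Equivalence)
open import Relation.Nullary using (¬_; yes; no)
open import Relation.Unary using (_⊆_)
open import Relation.Binary.Definitions using (DecidableEquality)
open import Relation.Binary.PropositionalEquality using (_≡_; _≢_; refl; sym)
open import Relation.Binary.Construct.Closure.ReflexiveTransitive using (ε; _◅_)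
import Relation.Binary.Construct.Closure.ReflexiveTransitive as Star
import Data.Bool.Properties as Bool
import Data.Vec.Properties as Vec
import Data.Product.Properties as Product

open Equivalence using (to; from)

_≟ₙ_ : ∀ {n} → DecidableEquality (Node n)
_≟ₙ_ = Product.≡-dec (Vec.≡-dec Bool._≟_)
         (Product.≡-dec (Vec.≡-dec Bool._≟_) (Vec.≡-dec Bool._≟_))

module SingleDeletionChain
  {A : Set} (_≟_ : DecidableEquality A)
  (k : ℕ) (G : ℕ → A → Set) (d : ℕ → A)
  (removes : ∀ {i} → i < k → ∀ x → G (suc i) x ⇔ (G i x × x ≢ d i))
  where

  G-shrinks : ∀ {i} → i < k → G (suc i) ⊆ G i
  G-shrinks i<k {x} = proj₁ ∘ to (removes i<k x)

  G-antitone : ∀ {i j} → i ≤′ j → j ≤ k → G j ⊆ G i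
  G-antitone ≤′-refl         _    = id
  G-antitone (≤′-step i≤′j) j<k = G-antitone i≤′j (<⇒≤ j<k) ∘ G-shrinks j<k

  deleted-between : ∀ {i j y} → i ≤′ j → j ≤ k → G i y → ¬ G j y →
                    ∃ λ m → i ≤ m × m < j × d m ≡ y
  deleted-between ≤′-refl _ y∈Gi y∉Gi = ⊥-elim (y∉Gi y∈Gi)
  deleted-between {y = y} (≤′-step {j} i≤′j) j<k y∈Gi y∉Gsj with d j ≟ y
  ... | yes dj≡y = j , ≤′⇒≤ i≤′j , n<1+n j , dj≡y
  ... | no  dj≢y =
    let m , i≤m , m<j , dm≡y = deleted-between i≤′j (<⇒≤ j<k) y∈Gi y∉Gj
    in  m , i≤m , m<n⇒m<1+n m<j , dm≡y
    where
      y∉Gj : ¬ G j y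
      y∉Gj y∈Gj = y∉Gsj (from (removes j<k y) (y∈Gj , dj≢y ∘ sym))

module _ {n : ℕ} {S : ClauseSet n} where

  PathIn-mono : ∀ {G H : NodeSet n} → G ⊆ H → ∀ {x y} → PathIn S G x y → PathIn S H x y
  PathIn-mono G⊆H = Star.map λ (x∈G , y∈G , x→y) → G⊆H x∈G , G⊆H y∈G , x→y

  PathIn-target : ∀ {G : NodeSet n} {x y} → PathIn S G x y → G x → G y
  PathIn-target ε                     x∈G = x∈G
  PathIn-target ((_ , z∈G , _) ◅ z→y) _   = PathIn-target z→y z∈G

  -- UnfulfillableEv S G m unfolds to ∃ λ l → Unfulfilled G l m.
  Unfulfilled : NodeSet n → Literal n → Node n → Set
  Unfulfilled G l m =
    (l ∈ₑ evs m) × ¬ (val m ⊨ₗ l) × ¬ (∃ λ y → PathIn S G m y × (val y ⊨ₗ l))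

  Unfulfilled-antitone : ∀ {G H : NodeSet n} {l m} → H ⊆ G → Unfulfilled G l m → Unfulfilled H l m
  Unfulfilled-antitone H⊆G (l∈E , l-fails , unreachable) =
    l∈E , l-fails , λ (y , m→y , l-holds) → unreachable (y , PathIn-mono H⊆G m→y , l-holds)

  Unfulfilled-along : ∀ {G : NodeSet n} {l x y} → PathIn S G x y → Unfulfilled G l x → Unfulfilled G l y
  Unfulfilled-along ε u = u
  Unfulfilled-along {l = l} (x→z@(_ , _ , _ , evs-rule) ◅ z→y) (l∈E , l-fails , unreachable) =
    Unfulfilled-along z→y
      ( from (evs-rule l) (inj₁ (l∈E , l-fails))
      , (λ l-holds → unreachable (_ , x→z ◅ ε , l-holds))
      , (λ (w , z→w , l-holds) → unreachable (w , x→z ◅ z→w , l-holds)) )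

lemma10 : ∀ {n : ℕ} (S : ClauseSet n) → (∀ (p : Fin n) → OccursIn p S) →
          (c : Construction S) →
          ∀ i → i < Construction.k c →
          ∀ y → PathIn S (Construction.G c i) (Construction.d c i) y →
          ∃ λ j → i ≤ j × j < Construction.k c × Construction.d c j ≡ y
lemma10 S _ c i i<k y ε = i , ≤-refl , i<k , refl
lemma10 S _ c i i<k y di→y@(di→z ◅ _) with Construction.steps c i i<k
... | (_ , inj₁ no-successors) , _ = ⊥-elim (no-successors _ di→z)
... | (di∈Gi , inj₂ (l , di-unfulfilled)) , _ =
  deleted-between i≤′k ≤-refl (PathIn-target di→y di∈Gi) y∉Gk
  where
    open Construction c
    open SingleDeletionChain _≟ₙ_ k G d (λ j<k → proj₂ (steps _ j<k))

    i≤′k : i ≤′ k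
    i≤′k = ≤⇒≤′ (<⇒≤ i<k)

    y∉Gk : ¬ G k y
    y∉Gk y∈Gk = final y (y∈Gk , inj₂ (l , Unfulfilled-antitone (G-antitone i≤′k ≤-refl)
                                            (Unfulfilled-along di→y di-unfulfilled)))
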